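{- Let $k$ and $n$ be positive integers. If $k$ divides $n$, then the path $P_k$ divides the hypercube $Q_n$.
   Context: $Q_n$ is the $n$-dimensional hypercube: vertex set the subsets of $\{1,\ldots,n\}$, with $x,y$ adjacent iff $|x\,\Delta\, y|=1$. $P_k$ denotes the path with $k$ edges. If $H$ is isomorphic to a subgraph of $G$, $H$ divides $G$ if there exist embeddings $\theta_1,\ldots,\theta_r$ of $H$ into $G$ such that $\{E(\theta_1(H)),\ldots,E(\theta_r(H))\}$ is a partition of $E(G)$. -}

module Defs where

open import Data.Nat using (ℕ; suc)
open import Data.Bool using (Bool; not)
open import Data.Fin using (Fin; inject₁) renaming (suc to fsuc)
open import Data.Vec using (Vec; _[_]%=_)
open import Data.Product using (Σ; _×_; ∃!)
open import Data.Sum using (_⊎_)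
open import Function.Definitions using (Injective)
open import Relation.Binary.PropositionalEquality using (_≡_)

-- Vertices of the hypercube Q_n: subsets of {1..n}, as characteristic vectors.
QVertex : ℕ → Set
QVertex n = Vec Bool n

QAdj : (n : ℕ) → QVertex n → QVertex n → Set
QAdj n x y = Σ (Fin n) λ i → y ≡ (x [ i ]%= not)

-- The path P_k: vertices 0..k (Fin (suc k)), edges {i, i+1} for i : Fin k.
-- An embedding of P_k into Q_n: an injective vertex map sending edges to edges.
record PathEmbedding (k n : ℕ) : Set where
  field
    vmap : Fin (suc k) → QVertex n
    injective : Injective _≡_ _≡_ vmap
    edges : (i : Fin k) → QAdj n (vmap (inject₁ i)) (vmap (fsuc i))
open PathEmbedding public

SameEdge : {A : Set} → A → A → A → A → Set
SameEdge a b u v = (a ≡ u × b ≡ v) ⊎ (a ≡ v × b ≡ u)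

EdgeOf : {k n r : ℕ} → (Fin r → PathEmbedding k n) → Fin r × Fin k →
         QVertex n → QVertex n → Set
EdgeOf θ (j Data.Product., i) u v =
  SameEdge (vmap (θ j) (inject₁ i)) (vmap (θ j) (fsuc i)) u v

-- P_k divides Q_n: there are embeddings θ_1..θ_r whose edge sets partition
-- E(Q_n), i.e. every edge of Q_n is the image of exactly one edge of exactly
-- one θ_j.
PathDividesCube : ℕ → ℕ → Set
PathDividesCube k n =
  Σ ℕ λ r → Σ (Fin r → PathEmbedding k n) λ θ →
    (u v : QVertex n) → QAdj n u v → ∃! _≡_ (λ p → EdgeOf θ p u v)

-- Write n = q·k and split the n coordinates into q blocks of k directions
-- each.  For a block b, listing its directions as d 0, …, d (k-1), the walk
-- from a vertex x that toggles d 0, d 1, … in turn is an embedding of P_k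
-- (its directions are distinct).  Take one such walk for every block b and
-- every vertex x of even parity.  An edge {u, toggle c u} of Q_n with
-- c = d_b i is the i-th edge of the block-b walk from x exactly when x is
-- y or toggle c y, where y is u walked back i steps; these two candidates
-- have opposite parities, so exactly one walk uses the edge.
module Submission where

open import Defs
open import Data.Nat using (ℕ; _≤_)
open import Data.Nat.Divisibility using (_∣_)

open import Data.Nat using (zero; suc; _+_; _*_)
open import Data.Nat.Divisibility using (divides)
open import Data.Bool using (Bool; true; false; not; _xor_)
open import Data.Bool.Properties
  using (xor-same; not-involutive; not-distribˡ-xor; not-distribʳ-xor; not-¬)
open import Data.Fin using (Fin; inject₁; splitAt; join; _↑ˡ_; _↑ʳ_; _≟_)
  renaming (zero to fzero; suc to fsuc)
open import Data.Fin.Properties using (0≢1+n; suc-injective; *↔×; splitAt-↑ˡ; splitAt-↑ʳ; join-splitAt)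
open import Data.Vec using (Vec; []; _∷_; lookup; tail; _[_]%=_)
open import Data.Vec.Properties
  using (updateAt-updateAt; updateAt-cong; updateAt-id; updateAt-commutes;
         lookup∘updateAt; lookup∘updateAt′; ∷-injectiveʳ)
open import Data.Product using (Σ; _×_; _,_; proj₁; proj₂; ∃!)
open import Data.Product.Function.NonDependent.Propositional using (_×-↔_)
open import Data.Sum using (_⊎_; inj₁; inj₂)
open import Data.Empty using (⊥; ⊥-elim)
open import Function using (_∘_)
open import Function.Bundles using (_↔_; Inverse; mk↔ₛ′)
open import Function.Definitions using (Injective)
open import Function.Properties.Inverse using (↔-refl; ↔-trans)
open import Relation.Nullary using (yes; no)
open import Relation.Binary.PropositionalEquality

private
  variable
    n k : ℕ

toggle : Fin n → QVertex n → QVertex n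
toggle c x = x [ c ]%= not

toggle-involutive : (c : Fin n) (x : QVertex n) → toggle c (toggle c x) ≡ x
toggle-involutive c x = begin
  (x [ c ]%= not) [ c ]%= not   ≡⟨ updateAt-updateAt c x ⟩
  x [ c ]%= (not ∘ not)         ≡⟨ updateAt-cong c not-involutive x ⟩
  x [ c ]%= (λ b → b)           ≡⟨ updateAt-id c x ⟩
  x                             ∎
  where open ≡-Reasoning

toggle-comm : (c d : Fin n) (x : QVertex n) → toggle c (toggle d x) ≡ toggle d (toggle c x)
toggle-comm c d x with c ≟ d
... | yes refl = refl
... | no c≢d = updateAt-commutes c d c≢d x

toggle-changes : (c : Fin n) (x : QVertex n) → lookup x c ≢ lookup (toggle c x) c
toggle-changes c x e = not-¬ refl (trans e (lookup∘updateAt c x))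

toggle-direction : (c d : Fin n) (x : QVertex n) → toggle c x ≡ toggle d x → c ≡ d
toggle-direction c d x e with c ≟ d
... | yes c≡d = c≡d
... | no c≢d = ⊥-elim (toggle-changes c x
      (trans (sym (lookup∘updateAt′ c d c≢d x)) (sym (cong (λ w → lookup w c) e))))

parity : QVertex n → Bool
parity [] = false
parity (a ∷ x) = a xor parity x

parity-toggle : (c : Fin n) (x : QVertex n) → parity (toggle c x) ≡ not (parity x)
parity-toggle fzero (a ∷ x) = sym (not-distribˡ-xor a (parity x))
parity-toggle (fsuc c) (a ∷ x) =
  trans (cong (a xor_) (parity-toggle c x)) (sym (not-distribʳ-xor a (parity x)))

Even : QVertex n → Set
Even x = parity x ≡ false

toggle-not-both-even : (c : Fin n) (y : QVertex n) → Even y → Even (toggle c y) → ⊥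
toggle-not-both-even c y ey ecy =
  not-¬ refl (trans ey (sym (trans (sym (parity-toggle c y)) ecy)))

even-end : (c : Fin n) (y : QVertex n) →
           Σ (QVertex n) λ x → Even x × (x ≡ y ⊎ x ≡ toggle c y)
even-end c y with parity y in py
... | false = y , py , inj₁ refl
... | true = toggle c y , trans (parity-toggle c y) (cong not py) , inj₂ refl

even-end-unique : (c : Fin n) (y x x′ : QVertex n) → Even x → Even x′ →
                  x ≡ y ⊎ x ≡ toggle c y → x′ ≡ y ⊎ x′ ≡ toggle c y → x ≡ x′
even-end-unique c y x x′ _ _ (inj₁ x≡y) (inj₁ x′≡y) = trans x≡y (sym x′≡y)
even-end-unique c y x x′ _ _ (inj₂ x≡cy) (inj₂ x′≡cy) = trans x≡cy (sym x′≡cy)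
even-end-unique c y x x′ ex ex′ (inj₁ refl) (inj₂ refl) = ⊥-elim (toggle-not-both-even c x ex ex′)
even-end-unique c y x x′ ex ex′ (inj₂ refl) (inj₁ refl) = ⊥-elim (toggle-not-both-even c x′ ex′ ex)

same-edge-toggle : (c d : Fin n) (u w : QVertex n) →
                   SameEdge w (toggle d w) u (toggle c u) → d ≡ c × (w ≡ u ⊎ w ≡ toggle c u)
same-edge-toggle c d u w (inj₁ (refl , dw≡cw)) = toggle-direction d c w dw≡cw , inj₁ refl
same-edge-toggle c d u w (inj₂ (refl , dw≡u)) =
  toggle-direction d c w (trans dw≡u (sym (toggle-involutive c u))) , inj₂ refl

end-same-edge : (c : Fin n) (u w : QVertex n) → w ≡ u ⊎ w ≡ toggle c u →
                SameEdge w (toggle c w) u (toggle c u)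
end-same-edge c u w (inj₁ refl) = inj₁ (refl , refl)
end-same-edge c u w (inj₂ refl) = inj₂ (refl , toggle-involutive c u)

walk : (Fin k → Fin n) → QVertex n → Fin (suc k) → QVertex n
walk d x fzero = x
walk {suc k} d x (fsuc t) = walk (d ∘ fsuc) (toggle (d fzero) x) t

walk-step : (d : Fin k → Fin n) (x : QVertex n) (i : Fin k) →
            walk d x (fsuc i) ≡ toggle (d i) (walk d x (inject₁ i))
walk-step d x fzero = refl
walk-step d x (fsuc i) = walk-step (d ∘ fsuc) (toggle (d fzero) x) i

walk-toggle : (d : Fin k → Fin n) (c : Fin n) (x : QVertex n) (t : Fin (suc k)) →
              walk d (toggle c x) t ≡ toggle c (walk d x t)
walk-toggle d c x fzero = refl
walk-toggle {suc k} d c x (fsuc t) = begin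
  walk (d ∘ fsuc) (toggle (d fzero) (toggle c x)) t   ≡⟨ cong (λ y → walk (d ∘ fsuc) y t) (toggle-comm (d fzero) c x) ⟩
  walk (d ∘ fsuc) (toggle c (toggle (d fzero) x)) t   ≡⟨ walk-toggle (d ∘ fsuc) c (toggle (d fzero) x) t ⟩
  toggle c (walk (d ∘ fsuc) (toggle (d fzero) x) t)   ∎
  where open ≡-Reasoning

walk-involutive : (d : Fin k → Fin n) (x : QVertex n) (t : Fin (suc k)) →
                  walk d (walk d x t) t ≡ x
walk-involutive d x fzero = refl
walk-involutive {suc k} d x (fsuc t) = begin
  walk d′ (toggle d₀ (walk d′ (toggle d₀ x) t)) t   ≡⟨ walk-toggle d′ d₀ _ t ⟩
  toggle d₀ (walk d′ (walk d′ (toggle d₀ x) t) t)   ≡⟨ cong (toggle d₀) (walk-involutive d′ (toggle d₀ x) t) ⟩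
  toggle d₀ (toggle d₀ x)                           ≡⟨ toggle-involutive d₀ x ⟩
  x                                                 ∎
  where
  open ≡-Reasoning
  d₀ : Fin _
  d₀ = d fzero
  d′ : Fin k → Fin _
  d′ = d ∘ fsuc

walk-start : (d : Fin k → Fin n) (x u : QVertex n) (t : Fin (suc k)) →
             walk d x t ≡ u → x ≡ walk d u t
walk-start d x u t refl = sym (walk-involutive d x t)

walk-avoiding : (d : Fin k → Fin n) (c : Fin n) → (∀ i → d i ≢ c) →
                (x : QVertex n) (t : Fin (suc k)) → lookup (walk d x t) c ≡ lookup x c
walk-avoiding d c avoid x fzero = refl
walk-avoiding {suc k} d c avoid x (fsuc t) =
  trans (walk-avoiding (d ∘ fsuc) c (avoid ∘ fsuc) (toggle (d fzero) x) t)
        (lookup∘updateAt′ c (d fzero) (avoid fzero ∘ sym) x)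

-- Along distinct directions a walk visits distinct vertices: after the
-- first step, coordinate d 0 stays toggled forever.
walk-injective : (d : Fin k → Fin n) → Injective _≡_ _≡_ d →
                 (x : QVertex n) → Injective _≡_ _≡_ (walk d x)
walk-injective d d-inj x {fzero} {fzero} _ = refl
walk-injective {suc k} d d-inj x {fzero} {fsuc t} e = ⊥-elim (toggle-changes (d fzero) x
  (trans (cong (λ y → lookup y (d fzero)) e) (walk-avoiding (d ∘ fsuc) (d fzero) later-directions _ t)))
  where
  later-directions : ∀ i → d (fsuc i) ≢ d fzero
  later-directions i e = 0≢1+n (sym (d-inj e))
walk-injective {suc k} d d-inj x {fsuc t} {fzero} e = sym (walk-injective d d-inj x {fzero} {fsuc t} (sym e))
walk-injective {suc k} d d-inj x {fsuc t} {fsuc t′} e =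
  cong fsuc (walk-injective (d ∘ fsuc) (λ e′ → suc-injective (d-inj e′)) (toggle (d fzero) x) e)

walk-path : (d : Fin k → Fin n) → Injective _≡_ _≡_ d → QVertex n → PathEmbedding k n
walk-path d d-inj x = record
  { vmap = walk d x
  ; injective = walk-injective d d-inj x
  ; edges = λ i → d i , walk-step d x i
  }

-- Edge i of the embedding with index a, for a family of embeddings indexed
-- by an arbitrary type (Defs.EdgeOf is the case of index type Fin r).
FamilyEdge : {I : Set} → (I → PathEmbedding k n) → I × Fin k → QVertex n → QVertex n → Set
FamilyEdge θ (a , i) u v = SameEdge (vmap (θ a) (inject₁ i)) (vmap (θ a) (fsuc i)) u v

Partitions : {I : Set} → (I → PathEmbedding k n) → Set
Partitions {n = n} θ = (u v : QVertex n) → QAdj n u v → ∃! _≡_ (λ p → FamilyEdge θ p u v)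

partition-divides : {I : Set} (r : ℕ) → Fin r ↔ I → (θ : I → PathEmbedding k n) →
                    Partitions θ → PathDividesCube k n
partition-divides r index θ partition = r , θ ∘ to , unique-edge
  where
  open Inverse index
  unique-edge : ∀ u v → QAdj _ u v → ∃! _≡_ (λ p → EdgeOf (θ ∘ to) p u v)
  unique-edge u v adj with partition u v adj
  ... | (a , i) , used , unique =
    (from a , i) , subst (λ a′ → FamilyEdge θ (a′ , i) u v) (sym (strictlyInverseˡ a)) used ,
    λ {(j , i′)} used′ → trans (cong (λ (a′ , i″) → (from a′ , i″)) (unique used′))
                               (cong (_, i′) (strictlyInverseʳ j))

walk-meets-edge : (d : Fin k → Fin n) (c : Fin n) (u x : QVertex n) (t : Fin (suc k)) →
                  walk d x t ≡ u ⊎ walk d x t ≡ toggle c u →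
                  x ≡ walk d u t ⊎ x ≡ toggle c (walk d u t)
walk-meets-edge d c u x t (inj₁ e) = inj₁ (walk-start d x u t e)
walk-meets-edge d c u x t (inj₂ e) = inj₂ (trans (walk-start d x _ t e) (walk-toggle d c u t))

edge-end-meets-walk : (d : Fin k → Fin n) (c : Fin n) (u x : QVertex n) (t : Fin (suc k)) →
                      x ≡ walk d u t ⊎ x ≡ toggle c (walk d u t) →
                      walk d x t ≡ u ⊎ walk d x t ≡ toggle c u
edge-end-meets-walk d c u x t (inj₁ refl) = inj₁ (walk-involutive d u t)
edge-end-meets-walk d c u x t (inj₂ refl) =
  inj₂ (trans (walk-toggle d c (walk d u t) t) (cong (toggle c) (walk-involutive d u t)))

-- Vertices of even parity, indexed by their last n coordinates.
even-vertex : Vec Bool n → QVertex (suc n)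
even-vertex z = parity z ∷ z

even-vertex-even : (z : Vec Bool n) → Even (even-vertex z)
even-vertex-even z = xor-same (parity z)

even-vertex-tail : (x : QVertex (suc n)) → Even x → even-vertex (tail x) ≡ x
even-vertex-tail (a ∷ z) ex = cong (_∷ z) (sym (xor-cancel a (parity z) ex))
  where
  xor-cancel : ∀ a b → a xor b ≡ false → a ≡ b
  xor-cancel false false _ = refl
  xor-cancel true true _ = refl

module BlockWalks {N q : ℕ} (coordinates : Fin (suc N) ↔ (Fin q × Fin k)) where
  open Inverse coordinates

  direction : Fin q → Fin k → Fin (suc N)
  direction b i = from (b , i)

  direction-determines : ∀ {b i b′ i′} → direction b i ≡ direction b′ i′ → (b , i) ≡ (b′ , i′)
  direction-determines {b} {i} {b′} {i′} e =
    trans (sym (strictlyInverseˡ (b , i))) (trans (cong to e) (strictlyInverseˡ (b′ , i′)))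

  direction-injective : (b : Fin q) → Injective _≡_ _≡_ (direction b)
  direction-injective b e = cong proj₂ (direction-determines e)

  blockWalk : Fin q × Vec Bool N → PathEmbedding k (suc N)
  blockWalk (b , z) = walk-path (direction b) (direction-injective b) (even-vertex z)

  uses-edge⇒ : ∀ b z i c u → FamilyEdge blockWalk ((b , z) , i) u (toggle c u) →
               direction b i ≡ c ×
               (even-vertex z ≡ walk (direction b) u (inject₁ i) ⊎
                even-vertex z ≡ toggle c (walk (direction b) u (inject₁ i)))
  uses-edge⇒ b z i c u used =
    dir≡c , walk-meets-edge (direction b) c u (even-vertex z) (inject₁ i) meets
    where
    w : QVertex (suc N)
    w = walk (direction b) (even-vertex z) (inject₁ i)
    edge : SameEdge w (toggle (direction b i) w) u (toggle c u)
    edge = subst (λ w′ → SameEdge w w′ u (toggle c u)) (walk-step (direction b) (even-vertex z) i) used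
    dir≡c : direction b i ≡ c
    dir≡c = proj₁ (same-edge-toggle c (direction b i) u w edge)
    meets : w ≡ u ⊎ w ≡ toggle c u
    meets = proj₂ (same-edge-toggle c (direction b i) u w edge)

  uses-edge⇐ : ∀ b z i c u → direction b i ≡ c →
               even-vertex z ≡ walk (direction b) u (inject₁ i) ⊎
               even-vertex z ≡ toggle c (walk (direction b) u (inject₁ i)) →
               FamilyEdge blockWalk ((b , z) , i) u (toggle c u)
  uses-edge⇐ b z i c u refl candidate =
    subst (λ w′ → SameEdge w w′ u (toggle c u)) (sym (walk-step (direction b) (even-vertex z) i))
      (end-same-edge c u w (edge-end-meets-walk (direction b) c u (even-vertex z) (inject₁ i) candidate))
    where
    w : QVertex (suc N)
    w = walk (direction b) (even-vertex z) (inject₁ i)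

  -- Two walks using the same edge coincide: the edge fixes the block and
  -- the step, and parity picks one of the two candidate starts.
  users-unique : ∀ {p p′} c u → FamilyEdge blockWalk p u (toggle c u) →
                 FamilyEdge blockWalk p′ u (toggle c u) → p ≡ p′
  users-unique {(b , z) , i} {(b′ , z′) , i′} c u used used′
    with uses-edge⇒ b z i c u used | uses-edge⇒ b′ z′ i′ c u used′
  ... | dir≡c , candidate | dir′≡c , candidate′
    with direction-determines (trans dir≡c (sym dir′≡c))
  ... | refl = cong (λ z″ → (b , z″) , i) (∷-injectiveʳ
                 (even-end-unique c _ _ _ (even-vertex-even z) (even-vertex-even z′) candidate candidate′))

  blockWalks-partition : Partitions blockWalk
  blockWalks-partition u _ (c , refl) with to c | strictlyInverseʳ c
  ... | b , i | refl with even-end c (walk (direction b) u (inject₁ i))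
  ... | x , ex , candidate = p , used , users-unique c u used
    where
    y : QVertex (suc N)
    y = walk (direction b) u (inject₁ i)
    p : (Fin q × Vec Bool N) × Fin k
    p = (b , tail x) , i
    used : FamilyEdge blockWalk p u (toggle c u)
    used = uses-edge⇐ b (tail x) i c u refl
             (subst (λ x′ → x′ ≡ y ⊎ x′ ≡ toggle c y) (sym (even-vertex-tail x ex)) candidate)

-- Q_n has pow2 n vertices; pow2 (suc n) = pow2 n + pow2 n so that
-- Fin (pow2 (suc n)) splits according to the first coordinate.
pow2 : ℕ → ℕ
pow2 zero = 1
pow2 (suc n) = pow2 n + pow2 n

to-vertex : (n : ℕ) → Fin (pow2 n) → Vec Bool n
to-vertex zero _ = []
to-vertex (suc n) j with splitAt (pow2 n) j
... | inj₁ a = false ∷ to-vertex n a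
... | inj₂ a = true ∷ to-vertex n a

from-vertex : Vec Bool n → Fin (pow2 n)
from-vertex [] = fzero
from-vertex {suc n} (false ∷ z) = from-vertex z ↑ˡ pow2 n
from-vertex {suc n} (true ∷ z) = pow2 n ↑ʳ from-vertex z

to-from-vertex : (z : Vec Bool n) → to-vertex n (from-vertex z) ≡ z
to-from-vertex [] = refl
to-from-vertex {suc n} (false ∷ z) rewrite splitAt-↑ˡ (pow2 n) (from-vertex z) (pow2 n) =
  cong (false ∷_) (to-from-vertex z)
to-from-vertex {suc n} (true ∷ z) rewrite splitAt-↑ʳ (pow2 n) (pow2 n) (from-vertex z) =
  cong (true ∷_) (to-from-vertex z)

join-of-split : ∀ {m l} {j : Fin (m + l)} {s} → splitAt m j ≡ s → join m l s ≡ j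
join-of-split {m} {l} {j} refl = join-splitAt m l j

from-to-vertex : (n : ℕ) (j : Fin (pow2 n)) → from-vertex (to-vertex n j) ≡ j
from-to-vertex zero fzero = refl
from-to-vertex (suc n) j with splitAt (pow2 n) j in split
... | inj₁ a = trans (cong (_↑ˡ pow2 n) (from-to-vertex n a)) (join-of-split split)
... | inj₂ a = trans (cong (pow2 n ↑ʳ_) (from-to-vertex n a)) (join-of-split split)

vertices : (n : ℕ) → Fin (pow2 n) ↔ Vec Bool n
vertices n = mk↔ₛ′ (to-vertex n) from-vertex to-from-vertex (from-to-vertex n)

-- With n = q·k, Fin n ≅ Fin q × Fin k splits the coordinates into q blocks
-- of k; there are q · pow2 (n-1) block walks, one per block and even vertex.
corollary1 : (k n : ℕ) → 1 ≤ k → 1 ≤ n → k ∣ n → PathDividesCube k n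
corollary1 k zero _ () _
corollary1 k (suc N) _ _ (divides q n≡q*k) =
  partition-divides (q * pow2 N) (↔-trans *↔× (↔-refl ×-↔ vertices N))
                    blockWalk blockWalks-partition
  where
  coordinates : Fin (suc N) ↔ (Fin q × Fin k)
  coordinates = subst (λ m → Fin m ↔ (Fin q × Fin k)) (sym n≡q*k) *↔×
  open BlockWalks coordinates
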